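{- Let $G_1$ and $G_2$ be two graphs, and let $V(\Gamma_1),\ldots,V(\Gamma_{t+t'-q})$, the families $X_i$ ($i\in I$) and the numbers $\varepsilon_i$ be as defined in the context. Then $D'(G_1+G_2)\leq\min\{\varepsilon_i\}_{i\in I}$.
   Context: All graphs are finite and simple. The join $G=G_1+G_2$ of $G_1=(V_1,E_1)$, $G_2=(V_2,E_2)$ (disjoint) has vertex set $V_1\cup V_2$ and edge set $E_1\cup E_2\cup\{uv:u\in V_1,v\in V_2\}$. The distinguishing index $D'(X)$ is the least $d$ such that $X$ has an edge colouring with $d$ colours preserved by no non-identity automorphism. $G[X]$ is an induced subgraph; $\overline{N_G(v)}=V(G)\setminus N_G(v)$ where $N_G(v)$ is the neighbourhood of $v$. Partition of $V_1$: choose $v_1\in V_1$, set $A:=\overline{N_G(v_1)}$; while some vertex $v$ of $G$ satisfies $\overline{N_G(v)}\cap A\neq\emptyset$ and $\overline{N_G(v)}\not\subseteq A$, replace $A$ by $A\cup\overline{N_G(v)}$; the final set is $A_1$. Choose a vertex of $V_1$ outside $A_1$ and repeat to get $A_2$, etc., giving $V_1=A_1\cup\cdots\cup A_k$; the same procedure gives $V_2=B_1\cup\cdots\cup B_{k'}$. Partition $\{G[A_1],\ldots,G[A_k]\}$ into isomorphism classes $\mathcal{A}_1,\ldots,\mathcal{A}_t$ and $\{G[B_1],\ldots,G[B_{k'}]\}$ into isomorphism classes $\mathcal{B}_1,\ldots,\mathcal{B}_{t'}$. Let $q$ be the number of classes $\mathcal{A}_i$ whose members are isomorphic to the members of some $\mathcal{B}_j$,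 indexed so that for $1\leq i\leq q$ members of $\mathcal{A}_i$ are isomorphic to members of $\mathcal{B}_i$ and no other such isomorphisms occur. Set $\Gamma_i=\mathcal{A}_i\cup\mathcal{B}_i$ for $1\leq i\leq q$, $\Gamma_{q+i}=\mathcal{A}_{q+i}$ for $1\leq i\leq t-q$, and $\Gamma_{t+i}=\mathcal{B}_{q+i}$ for $1\leq i\leq t'-q$, and let $V(\Gamma_s)$ be the union of the vertex sets of the graphs in $\Gamma_s$. For $s\neq s'$, $K_{|V(\Gamma_s)|,|V(\Gamma_{s'})|}$ denotes the complete bipartite graph with parts $V(\Gamma_s)$ and $V(\Gamma_{s'})$. Let $X_i$, $i\in I$, range over all sets of such complete bipartite graphs (each with two distinct parts $V(\Gamma_s)\neq V(\Gamma_{s'})$) such that the set of all parts used by members of $X_i$ is exactly $\{V(\Gamma_1),\ldots,V(\Gamma_{t+t'-q})\}$. Put $\varepsilon_i=\max\{D'(K_{|V(\Gamma_s)|,|V(\Gamma_{s'})|}): K_{|V(\Gamma_s)|,|V(\Gamma_{s'})|}\in X_i\}$. -}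

module Defs where

open import Data.Nat using (ℕ; _+_; _≤_)
open import Data.Bool using (Bool; true; false; _∧_)
open import Data.Fin using (Fin; splitAt)
open import Data.Fin.Permutation using (Permutation′; _⟨$⟩ʳ_)
open import Data.Sum using (_⊎_; inj₁; inj₂)
open import Data.Product using (Σ; _×_; _,_)
open import Data.List using (List; length)
open import Data.List.Membership.Propositional using (_∈_)
open import Data.List.Relation.Unary.Unique.Propositional using (Unique)
open import Function.Bundles using (_⇔_)
open import Relation.Nullary using (¬_)
open import Relation.Binary.PropositionalEquality using (_≡_)

record Graph (n : ℕ) : Set where
  field
    adj    : Fin n → Fin n → Bool
    sym    : ∀ u v → adj u v ≡ adj v u
    irrefl : ∀ v → adj v v ≡ false
open Graph public

empty : (n : ℕ) → Graph n
empty n = record { adj = λ _ _ → false ; sym = λ _ _ → _≡_.refl ; irrefl = λ _ → _≡_.refl }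

joinAdj : ∀ {n1 n2} → Graph n1 → Graph n2 → Fin (n1 + n2) → Fin (n1 + n2) → Bool
joinAdj {n1} G1 G2 x y with splitAt n1 x | splitAt n1 y
... | inj₁ a | inj₁ b = adj G1 a b
... | inj₂ a | inj₂ b = adj G2 a b
... | inj₁ _ | inj₂ _ = true
... | inj₂ _ | inj₁ _ = true

joinSym : ∀ {n1 n2} (G1 : Graph n1) (G2 : Graph n2) (x y : Fin (n1 + n2)) →
          joinAdj G1 G2 x y ≡ joinAdj G1 G2 y x
joinSym {n1} G1 G2 x y with splitAt n1 x | splitAt n1 y
... | inj₁ a | inj₁ b = sym G1 a b
... | inj₂ a | inj₂ b = sym G2 a b
... | inj₁ _ | inj₂ _ = _≡_.refl
... | inj₂ _ | inj₁ _ = _≡_.refl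

joinIrrefl : ∀ {n1 n2} (G1 : Graph n1) (G2 : Graph n2) (x : Fin (n1 + n2)) →
             joinAdj G1 G2 x x ≡ false
joinIrrefl {n1} G1 G2 x with splitAt n1 x
... | inj₁ a = irrefl G1 a
... | inj₂ a = irrefl G2 a

_+ᴳ_ : ∀ {n1 n2} → Graph n1 → Graph n2 → Graph (n1 + n2)
G1 +ᴳ G2 = record { adj = joinAdj G1 G2 ; sym = joinSym G1 G2 ; irrefl = joinIrrefl G1 G2 }

K : (a b : ℕ) → Graph (a + b)
K a b = empty a +ᴳ empty b

IsAut : ∀ {n} → Graph n → Permutation′ n → Set
IsAut G σ = ∀ u v → adj G (σ ⟨$⟩ʳ u) (σ ⟨$⟩ʳ v) ≡ adj G u v

record EdgeColouring {n} (G : Graph n) (d : ℕ) : Set where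
  field
    col    : Fin n → Fin n → Fin d
    colSym : ∀ u v → adj G u v ≡ true → col u v ≡ col v u
open EdgeColouring public

Preserves : ∀ {n} {G : Graph n} {d} → Permutation′ n → EdgeColouring G d → Set
Preserves {G = G} σ c = ∀ u v → adj G u v ≡ true → col c (σ ⟨$⟩ʳ u) (σ ⟨$⟩ʳ v) ≡ col c u v

Distinguishing : ∀ {n} (G : Graph n) {d} → EdgeColouring G d → Set
Distinguishing {n} G c = (σ : Permutation′ n) → IsAut G σ → Preserves σ c → ∀ x → σ ⟨$⟩ʳ x ≡ x

D′≤ : ∀ {n} → Graph n → ℕ → Set
D′≤ G m = Σ ℕ λ d → d ≤ m × Σ (EdgeColouring G d) λ c → Distinguishing G c

InN̄ : ∀ {n} → Graph n → Fin n → Fin n → Set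
InN̄ G v u = adj G v u ≡ false

-- The set A produced by the procedure started at v: the least set containing N̄(v)
-- such that whenever N̄(w) meets A, N̄(w) ⊆ A.
data Part {n} (G : Graph n) (v : Fin n) : Fin n → Set where
  base : ∀ {u} → InN̄ G v u → Part G v u
  step : ∀ {w a u} → InN̄ G w a → Part G v a → InN̄ G w u → Part G v u

record IsoInduced {n} (G : Graph n) (A B : Fin n → Set) : Set where
  field
    f     : Fin n → Fin n
    g     : Fin n → Fin n
    f∈    : ∀ {u} → A u → B (f u)
    g∈    : ∀ {u} → B u → A (g u)
    gf    : ∀ {u} → A u → g (f u) ≡ u
    fg    : ∀ {u} → B u → f (g u) ≡ u
    f-adj : ∀ {u v} → A u → A v → adj G (f u) (f v) ≡ adj G u v

-- x ≈ y : the parts containing x and y are in the same class Γ_s,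
-- i.e. x and y lie in the same V(Γ_s).
SameΓ : ∀ {n} → Graph n → Fin n → Fin n → Set
SameΓ G x y = IsoInduced G (Part G x) (Part G y)

HasSize : ∀ {n} → (Fin n → Set) → ℕ → Set
HasSize {n} P a = Σ (List (Fin n)) λ L → Unique L × length L ≡ a × (∀ z → (z ∈ L) ⇔ P z)

-- The classes V(Γ_s) form a partition of V(G) which every automorphism fixes setwise
-- (it maps each part A_i onto an isomorphic part), and two vertices in different classes
-- are adjacent (non-adjacent vertices lie in a common part). Colour an edge between
-- V(Γ_s) and V(Γ_s') by a distinguishing colouring of K_{|V(Γ_s)|,|V(Γ_s')|}, using the
-- first pair of X that joins these two classes, and all other edges arbitrarily. An
-- automorphism σ preserving this colouring restricts, on the two classes of each pair of
-- X, to an automorphism of the corresponding complete bipartite graph preserving its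
-- distinguishing colouring, so σ is the identity there; the pairs of X cover all classes.
-- Nothing about joins is needed beyond these two properties of the classes.
module Submission where

open import Defs hiding (sym)
open import Data.Nat using (ℕ; _+_; _≤_; z≤n)
open import Data.Nat.Properties using (≤-refl)
open import Data.Fin using (Fin; zero; suc; splitAt; join; _↑ˡ_; _↑ʳ_; inject≤)
open import Data.Fin.Properties
  using ( +↔⊎; splitAt-↑ˡ; splitAt-↑ʳ; splitAt-join; splitAt⁻¹-↑ˡ; splitAt⁻¹-↑ʳ
        ; ↑ˡ-injective; ↑ʳ-injective; inject≤-injective)
  renaming (_≟_ to _≟ᶠ_)
open import Data.Fin.Permutation
  using (Permutation′; _⟨$⟩ʳ_; _⟨$⟩ˡ_; inverseˡ; inverseʳ; permutation; flip) renaming (id to idₚ)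
open import Data.Sum.Function.Propositional using (_⊎-↔_)
open import Function.Construct.Composition using (_↔-∘_)
open import Function.Construct.Symmetry using (↔-sym)
open import Data.Bool using (Bool; true; false)
open import Data.Sum using (_⊎_; inj₁; inj₂)
import Data.Sum as Sum
open import Data.Product using (Σ; _×_; _,_; proj₁; proj₂)
open import Data.Maybe using (Maybe; just; nothing; fromMaybe)
open import Data.List using (List; []; _∷_; length; lookup)
open import Data.List.Relation.Unary.All using (All; []; _∷_)
import Data.List.Relation.Unary.All as All
open import Data.List.Relation.Unary.Any using (Any; here; there; index)
open import Data.List.Relation.Unary.Any.Properties using (¬Any[]; lookup-index)
open import Data.List.Relation.Unary.AllPairs using (_∷_)
open import Data.List.Relation.Unary.Unique.Propositional using (Unique)
open import Data.List.Membership.Propositional using (_∈_; find)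
open import Data.List.Membership.Propositional.Properties using (∈-lookup)
import Data.List.Membership.DecPropositional as DecMembership
open import Function.Bundles using (_⇔_; Equivalence)
open import Relation.Nullary using (¬_; Dec; yes; no)
open import Relation.Nullary.Decidable using (_×-dec_; _⊎-dec_)
open import Relation.Binary.Structures using (IsEquivalence)
open import Data.Empty using (⊥; ⊥-elim)
open import Relation.Binary.PropositionalEquality
  using (_≡_; refl; sym; trans; cong; cong₂; subst; module ≡-Reasoning)

open Equivalence using (to; from)

lookup-injective : ∀ {A : Set} {xs : List A} → Unique xs → ∀ i j → lookup xs i ≡ lookup xs j → i ≡ j
lookup-injective (_ ∷ _)  zero    zero    _  = refl
lookup-injective (x∉ ∷ _) zero    (suc j) eq = ⊥-elim (All.lookup x∉ (∈-lookup j) eq)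
lookup-injective (x∉ ∷ _) (suc i) zero    eq = ⊥-elim (All.lookup x∉ (∈-lookup i) (sym eq))
lookup-injective (_ ∷ u)  (suc i) (suc j) eq = cong suc (lookup-injective u i j eq)

module _ {A : Set} {xs : List A} (xs-unique : Unique xs) where

  index-lookup : ∀ {i} (p : lookup xs i ∈ xs) → index p ≡ i
  index-lookup {i} p = lookup-injective xs-unique (index p) i (sym (lookup-index p))

  index-irrelevant : ∀ {x} (p q : x ∈ xs) → index p ≡ index q
  index-irrelevant p q = lookup-injective xs-unique (index p) (index q) (trans (sym (lookup-index p)) (lookup-index q))

-- Restricting a permutation to an invariant list

Invariant : ∀ {n} → (Fin n → Fin n) → List (Fin n) → Set
Invariant f L = ∀ {w} → w ∈ L → f w ∈ L

module _ {n} {L : List (Fin n)} (L-unique : Unique L) where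

  reindex : (f : Fin n → Fin n) → Invariant f L → Fin (length L) → Fin (length L)
  reindex f f-closed i = index (f-closed (∈-lookup i))

  lookup-reindex : ∀ f (f-closed : Invariant f L) i → lookup L (reindex f f-closed i) ≡ f (lookup L i)
  lookup-reindex f f-closed i = sym (lookup-index (f-closed (∈-lookup i)))

  reindex-inverse : ∀ f (f-closed : Invariant f L) g (g-closed : Invariant g L) → (∀ w → f (g w) ≡ w) →
                    ∀ i → reindex f f-closed (reindex g g-closed i) ≡ i
  reindex-inverse f f-closed g g-closed fg i = lookup-injective L-unique _ i (begin
      lookup L (reindex f f-closed (reindex g g-closed i)) ≡⟨ lookup-reindex f f-closed _ ⟩
      f (lookup L (reindex g g-closed i))                  ≡⟨ cong f (lookup-reindex g g-closed i) ⟩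
      f (g (lookup L i))                                   ≡⟨ fg (lookup L i) ⟩
      lookup L i                                           ∎)
    where open ≡-Reasoning

  restrict : (σ : Permutation′ n) → Invariant (σ ⟨$⟩ʳ_) L → Invariant (σ ⟨$⟩ˡ_) L →
             Permutation′ (length L)
  restrict σ σ-closed σ⁻¹-closed =
    permutation (reindex (σ ⟨$⟩ʳ_) σ-closed) (reindex (σ ⟨$⟩ˡ_) σ⁻¹-closed)
      (reindex-inverse _ σ-closed _ σ⁻¹-closed (λ _ → inverseʳ σ))
      (reindex-inverse _ σ⁻¹-closed _ σ-closed (λ _ → inverseˡ σ))

-- Complete bipartite graphs

_⊕ₚ_ : ∀ {a b} → Permutation′ a → Permutation′ b → Permutation′ (a + b)
π ⊕ₚ ρ = ↔-sym +↔⊎ ↔-∘ ((π ⊎-↔ ρ) ↔-∘ +↔⊎)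

module _ {a b} (π : Permutation′ a) (ρ : Permutation′ b) where

  ⊕ₚ-↑ˡ : ∀ i → (π ⊕ₚ ρ) ⟨$⟩ʳ (i ↑ˡ b) ≡ (π ⟨$⟩ʳ i) ↑ˡ b
  ⊕ₚ-↑ˡ i = cong (λ s → join a b (Sum.map (π ⟨$⟩ʳ_) (ρ ⟨$⟩ʳ_) s)) (splitAt-↑ˡ a i b)

  ⊕ₚ-↑ʳ : ∀ j → (π ⊕ₚ ρ) ⟨$⟩ʳ (a ↑ʳ j) ≡ a ↑ʳ (ρ ⟨$⟩ʳ j)
  ⊕ₚ-↑ʳ j = cong (λ s → join a b (Sum.map (π ⟨$⟩ʳ_) (ρ ⟨$⟩ʳ_) s)) (splitAt-↑ʳ a b j)

crossing : ∀ {a b} → Fin a ⊎ Fin b → Fin a ⊎ Fin b → Bool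
crossing (inj₁ _) (inj₁ _) = false
crossing (inj₁ _) (inj₂ _) = true
crossing (inj₂ _) (inj₁ _) = true
crossing (inj₂ _) (inj₂ _) = false

crossing-map : ∀ {a b} (f : Fin a → Fin a) (g : Fin b → Fin b) s t →
               crossing (Sum.map f g s) (Sum.map f g t) ≡ crossing s t
crossing-map f g (inj₁ _) (inj₁ _) = refl
crossing-map f g (inj₁ _) (inj₂ _) = refl
crossing-map f g (inj₂ _) (inj₁ _) = refl
crossing-map f g (inj₂ _) (inj₂ _) = refl

K-adj : ∀ a b u v → adj (K a b) u v ≡ crossing (splitAt a u) (splitAt a v)
K-adj a b u v with splitAt a u | splitAt a v
... | inj₁ _ | inj₁ _ = refl
... | inj₁ _ | inj₂ _ = refl
... | inj₂ _ | inj₁ _ = refl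
... | inj₂ _ | inj₂ _ = refl

module _ {a b : ℕ} where

  K-adj-left-left : ∀ i i′ → adj (K a b) (i ↑ˡ b) (i′ ↑ˡ b) ≡ false
  K-adj-left-left i i′ = trans (K-adj a b _ _) (cong₂ crossing (splitAt-↑ˡ a i b) (splitAt-↑ˡ a i′ b))

  K-adj-right-right : ∀ j j′ → adj (K a b) (a ↑ʳ j) (a ↑ʳ j′) ≡ false
  K-adj-right-right j j′ = trans (K-adj a b _ _) (cong₂ crossing (splitAt-↑ʳ a b j) (splitAt-↑ʳ a b j′))

⊕ₚ-isAut : ∀ {a b} (π : Permutation′ a) (ρ : Permutation′ b) → IsAut (K a b) (π ⊕ₚ ρ)
⊕ₚ-isAut {a} {b} π ρ u v = begin
    adj (K a b) (τ ⟨$⟩ʳ u) (τ ⟨$⟩ʳ v)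
      ≡⟨ K-adj a b _ _ ⟩
    crossing (splitAt a (τ ⟨$⟩ʳ u)) (splitAt a (τ ⟨$⟩ʳ v))
      ≡⟨ cong₂ crossing (splitAt-join a b _) (splitAt-join a b _) ⟩
    crossing (π⊎ρ (splitAt a u)) (π⊎ρ (splitAt a v))
      ≡⟨ crossing-map _ _ (splitAt a u) (splitAt a v) ⟩
    crossing (splitAt a u) (splitAt a v)
      ≡⟨ K-adj a b u v ⟨
    adj (K a b) u v
      ∎
  where
  open ≡-Reasoning
  τ : Permutation′ (a + b)
  τ = π ⊕ₚ ρ
  π⊎ρ : Fin a ⊎ Fin b → Fin a ⊎ Fin b
  π⊎ρ = Sum.map (π ⟨$⟩ʳ_) (ρ ⟨$⟩ʳ_)

data Side (a b : ℕ) : Fin (a + b) → Set where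
  left  : ∀ i → Side a b (i ↑ˡ b)
  right : ∀ j → Side a b (a ↑ʳ j)

side : ∀ a b k → Side a b k
side a b k with splitAt a k in eq
... | inj₁ i = subst (Side a b) (splitAt⁻¹-↑ˡ eq) (left i)
... | inj₂ j = subst (Side a b) (splitAt⁻¹-↑ʳ eq) (right j)

module _ {a b d} (c : EdgeColouring (K a b) d) {π : Permutation′ a} {ρ : Permutation′ b}
         (cross : ∀ i j → col c ((π ⟨$⟩ʳ i) ↑ˡ b) (a ↑ʳ (ρ ⟨$⟩ʳ j)) ≡ col c (i ↑ˡ b) (a ↑ʳ j)) where

  ⊕ₚ-preserves : Preserves (π ⊕ₚ ρ) c
  ⊕ₚ-preserves u v = preserves (side a b u) (side a b v)
    where
    τ : Permutation′ (a + b)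
    τ = π ⊕ₚ ρ

    preserves-left-right : ∀ i j → col c (τ ⟨$⟩ʳ (i ↑ˡ b)) (τ ⟨$⟩ʳ (a ↑ʳ j)) ≡ col c (i ↑ˡ b) (a ↑ʳ j)
    preserves-left-right i j = trans (cong₂ (col c) (⊕ₚ-↑ˡ π ρ i) (⊕ₚ-↑ʳ π ρ j)) (cross i j)

    preserves : ∀ {u v} → Side a b u → Side a b v → adj (K a b) u v ≡ true →
                col c (τ ⟨$⟩ʳ u) (τ ⟨$⟩ʳ v) ≡ col c u v
    preserves (left i) (right j) _ = preserves-left-right i j
    preserves (right j) (left i) uv = begin
        col c (τ ⟨$⟩ʳ (a ↑ʳ j)) (τ ⟨$⟩ʳ (i ↑ˡ b)) ≡⟨ colSym c _ _ (trans (⊕ₚ-isAut π ρ _ _) uv) ⟩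
        col c (τ ⟨$⟩ʳ (i ↑ˡ b)) (τ ⟨$⟩ʳ (a ↑ʳ j)) ≡⟨ preserves-left-right i j ⟩
        col c (i ↑ˡ b) (a ↑ʳ j)                 ≡⟨ colSym c _ _ uv ⟨
        col c (a ↑ʳ j) (i ↑ˡ b)                 ∎
      where open ≡-Reasoning
    preserves (left i) (left i′) uv with trans (sym uv) (K-adj-left-left i i′)
    ... | ()
    preserves (right j) (right j′) uv with trans (sym uv) (K-adj-right-right {a} j j′)
    ... | ()

  cross-preserving⇒identity : Distinguishing (K a b) c →
                              (∀ i → π ⟨$⟩ʳ i ≡ i) × (∀ j → ρ ⟨$⟩ʳ j ≡ j)
  cross-preserving⇒identity c-distinguishing =
      (λ i → ↑ˡ-injective b _ _ (trans (sym (⊕ₚ-↑ˡ π ρ i)) (fixed (i ↑ˡ b))))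
    , (λ j → ↑ʳ-injective a _ _ (trans (sym (⊕ₚ-↑ʳ π ρ j)) (fixed (a ↑ʳ j))))
    where
    fixed : ∀ k → (π ⊕ₚ ρ) ⟨$⟩ʳ k ≡ k
    fixed = c-distinguishing (π ⊕ₚ ρ) (⊕ₚ-isAut π ρ) ⊕ₚ-preserves

-- Induced subgraphs and the classes V(Γ_s)

module _ {n} (G : Graph n) where

  isAut-flip : ∀ σ → IsAut G σ → IsAut G (flip σ)
  isAut-flip σ aut u v = trans (sym (aut (σ ⟨$⟩ˡ u) (σ ⟨$⟩ˡ v))) (cong₂ (adj G) (inverseʳ σ) (inverseʳ σ))

  IsoInduced-viaAut : ∀ σ → IsAut G σ → {A B : Fin n → Set} →
                      (∀ {u} → A u → B (σ ⟨$⟩ʳ u)) → (∀ {u} → B u → A (σ ⟨$⟩ˡ u)) → IsoInduced G A B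
  IsoInduced-viaAut σ aut σ[A]⊆B σ⁻¹[B]⊆A = record
    { f = σ ⟨$⟩ʳ_ ; g = σ ⟨$⟩ˡ_ ; f∈ = σ[A]⊆B ; g∈ = σ⁻¹[B]⊆A
    ; gf = λ _ → inverseˡ σ ; fg = λ _ → inverseʳ σ ; f-adj = λ _ _ → aut _ _ }

  IsoInduced-sym : ∀ {A B} → IsoInduced G A B → IsoInduced G B A
  IsoInduced-sym I = record
    { f = g ; g = f ; f∈ = g∈ ; g∈ = f∈ ; gf = fg ; fg = gf
    ; f-adj = λ u∈ v∈ → trans (sym (f-adj (g∈ u∈) (g∈ v∈))) (cong₂ (adj G) (fg u∈) (fg v∈)) }
    where open IsoInduced I

  IsoInduced-trans : ∀ {A B C} → IsoInduced G A B → IsoInduced G B C → IsoInduced G A C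
  IsoInduced-trans I J = record
    { f = λ u → J.f (I.f u) ; g = λ u → I.g (J.g u)
    ; f∈ = λ u∈ → J.f∈ (I.f∈ u∈) ; g∈ = λ u∈ → I.g∈ (J.g∈ u∈)
    ; gf = λ u∈ → trans (cong I.g (J.gf (I.f∈ u∈))) (I.gf u∈)
    ; fg = λ u∈ → trans (cong J.f (I.fg (J.g∈ u∈))) (J.fg u∈)
    ; f-adj = λ u∈ v∈ → trans (J.f-adj (I.f∈ u∈) (I.f∈ v∈)) (I.f-adj u∈ v∈) }
    where
    module I = IsoInduced I
    module J = IsoInduced J

  Part-map : ∀ σ → IsAut G σ → ∀ {z u} → Part G z u → Part G (σ ⟨$⟩ʳ z) (σ ⟨$⟩ʳ u)
  Part-map σ aut (base z≁u)         = base (trans (aut _ _) z≁u)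
  Part-map σ aut (step w≁a a∈ w≁u) = step (trans (aut _ _) w≁a) (Part-map σ aut a∈) (trans (aut _ _) w≁u)

  Part-transfer : ∀ {u v w} → adj G u v ≡ false → Part G u w → Part G v w
  Part-transfer {u} {v} u≁v (base u≁w) = step (irrefl G u) (base (trans (Graph.sym G v u) u≁v)) u≁w
  Part-transfer u≁v (step w≁a a∈ w≁u)  = step w≁a (Part-transfer u≁v a∈) w≁u

  SameΓ-isEquivalence : IsEquivalence (SameΓ G)
  SameΓ-isEquivalence = record
    { refl  = IsoInduced-viaAut idₚ (λ _ _ → refl) (λ u∈ → u∈) (λ u∈ → u∈)
    ; sym   = IsoInduced-sym
    ; trans = IsoInduced-trans }

  SameΓ-aut : ∀ σ → IsAut G σ → ∀ z → SameΓ G z (σ ⟨$⟩ʳ z)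
  SameΓ-aut σ aut z = IsoInduced-viaAut σ aut (Part-map σ aut)
    (λ u∈ → subst (λ z′ → Part G z′ _) (inverseˡ σ) (Part-map (flip σ) (isAut-flip σ aut) u∈))

  SameΓ-nonadjacent : ∀ {u v} → adj G u v ≡ false → SameΓ G u v
  SameΓ-nonadjacent {u} {v} u≁v =
    IsoInduced-viaAut idₚ (λ _ _ → refl) (Part-transfer u≁v) (Part-transfer (trans (Graph.sym G v u) u≁v))

  ¬SameΓ⇒adjacent : ∀ {u v} → ¬ SameΓ G u v → adj G u v ≡ true
  ¬SameΓ⇒adjacent {u} {v} u≉v with adj G u v in eq
  ... | true  = refl
  ... | false = ⊥-elim (u≉v (SameΓ-nonadjacent eq))

-- Colouring a graph blockwise from complete bipartite graphs between its classes

module JoinedClasses {n} (G : Graph n) {_≈_ : Fin n → Fin n → Set} (≈-isEquivalence : IsEquivalence _≈_)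
                     (≈-aut : ∀ σ → IsAut G σ → ∀ z → z ≈ (σ ⟨$⟩ʳ z))
                     (≉⇒adjacent : ∀ {u v} → ¬ u ≈ v → adj G u v ≡ true)
                     (m : ℕ) where

  open IsEquivalence ≈-isEquivalence renaming (refl to ≈-refl; sym to ≈-sym; trans to ≈-trans)
  open DecMembership (_≟ᶠ_ {n}) using (_∈?_)

  record Enumeration (x : Fin n) : Set where
    field
      members : List (Fin n)
      unique  : Unique members
      ∈⇔≈    : ∀ z → z ∈ members ⇔ z ≈ x

    size : ℕ
    size = length members

    ∈⇒≈ : ∀ {z} → z ∈ members → z ≈ x
    ∈⇒≈ {z} = to (∈⇔≈ z)

    ≈⇒∈ : ∀ {z} → z ≈ x → z ∈ members
    ≈⇒∈ {z} = from (∈⇔≈ z)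

    ∈-resp-≈ : ∀ {u u′} → u ≈ u′ → u ∈ members → u′ ∈ members
    ∈-resp-≈ u≈u′ u∈ = ≈⇒∈ (≈-trans (≈-sym u≈u′) (∈⇒≈ u∈))

    co-members : ∀ {u v} → u ∈ members → v ∈ members → u ≈ v
    co-members u∈ v∈ = ≈-trans (∈⇒≈ u∈) (≈-sym (∈⇒≈ v∈))

    autInvariant : ∀ σ → IsAut G σ → Invariant (σ ⟨$⟩ʳ_) members
    autInvariant σ aut = ∈-resp-≈ (≈-aut σ aut _)

    restrictAut : ∀ σ → IsAut G σ → Permutation′ size
    restrictAut σ aut = restrict unique σ (autInvariant σ aut) (autInvariant (flip σ) (isAut-flip G σ aut))

    lookup-restrictAut : ∀ σ aut i → lookup members (restrictAut σ aut ⟨$⟩ʳ i) ≡ σ ⟨$⟩ʳ lookup members i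
    lookup-restrictAut σ aut = lookup-reindex unique _ (autInvariant σ aut)

    restrictAut-identity : ∀ σ aut → (∀ i → restrictAut σ aut ⟨$⟩ʳ i ≡ i) →
                           ∀ {z} → z ∈ members → σ ⟨$⟩ʳ z ≡ z
    restrictAut-identity σ aut identity {z} z∈ = begin
        σ ⟨$⟩ʳ z                                       ≡⟨ cong (σ ⟨$⟩ʳ_) (lookup-index z∈) ⟩
        σ ⟨$⟩ʳ lookup members (index z∈)                ≡⟨ lookup-restrictAut σ aut (index z∈) ⟨
        lookup members (restrictAut σ aut ⟨$⟩ʳ index z∈) ≡⟨ cong (lookup members) (identity (index z∈)) ⟩
        lookup members (index z∈)                       ≡⟨ lookup-index z∈ ⟨
        z                                               ∎
      where open ≡-Reasoning

  enumeration : ∀ {x a} → HasSize (_≈ x) a → Enumeration x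
  enumeration (L , L-unique , _ , ∈⇔≈) = record { members = L ; unique = L-unique ; ∈⇔≈ = ∈⇔≈ }

  record Witness (x y : Fin n) : Set where
    field
      classˡ         : Enumeration x
      classʳ         : Enumeration y
      x≉y            : ¬ x ≈ y
      colours        : ℕ
      colours≤m      : colours ≤ m
      colouring      : EdgeColouring (K (Enumeration.size classˡ) (Enumeration.size classʳ)) colours
      distinguishing : Distinguishing (K (Enumeration.size classˡ) (Enumeration.size classʳ)) colouring

  mkWitness : ∀ {x y} → ¬ x ≈ y →
              (Σ ℕ λ a → Σ ℕ λ b → HasSize (_≈ x) a × HasSize (_≈ y) b × D′≤ (K a b) m) → Witness x y
  mkWitness x≉y (_ , _ , sizeˣ@(_ , _ , refl , _) , sizeʸ@(_ , _ , refl , _) , d , d≤m , c , c-distinguishing) =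
    record { classˡ = enumeration sizeˣ ; classʳ = enumeration sizeʸ ; x≉y = x≉y
           ; colours = d ; colours≤m = d≤m ; colouring = c ; distinguishing = c-distinguishing }

  SameBlock : Fin n → Fin n → Fin n → Fin n → Set
  SameBlock u v u′ v′ = (u ≈ u′ × v ≈ v′) ⊎ (u ≈ v′ × v ≈ u′)

  SameBlock-sym : ∀ {u v u′ v′} → SameBlock u v u′ v′ → SameBlock u′ v′ u v
  SameBlock-sym (inj₁ (u≈u′ , v≈v′)) = inj₁ (≈-sym u≈u′ , ≈-sym v≈v′)
  SameBlock-sym (inj₂ (u≈v′ , v≈u′)) = inj₂ (≈-sym v≈u′ , ≈-sym u≈v′)

  module _ {x y} (w : Witness x y) where
    open Witness w
    private
      module ˡ = Enumeration classˡ
      module ʳ = Enumeration classʳ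

    Matches : Fin n → Fin n → Set
    Matches u v = (u ∈ ˡ.members × v ∈ ʳ.members) ⊎ (u ∈ ʳ.members × v ∈ ˡ.members)

    matches? : ∀ u v → Dec (Matches u v)
    matches? u v = (u ∈? ˡ.members ×-dec v ∈? ʳ.members) ⊎-dec (u ∈? ʳ.members ×-dec v ∈? ˡ.members)

    matches-self : Matches x y
    matches-self = inj₁ (ˡ.≈⇒∈ ≈-refl , ʳ.≈⇒∈ ≈-refl)

    Matches-swap : ∀ {u v} → Matches u v → Matches v u
    Matches-swap (inj₁ (u∈ , v∈)) = inj₂ (v∈ , u∈)
    Matches-swap (inj₂ (u∈ , v∈)) = inj₁ (v∈ , u∈)

    Matches-resp-≈ : ∀ {u u′ v v′} → u ≈ u′ → v ≈ v′ → Matches u v → Matches u′ v′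
    Matches-resp-≈ u≈u′ v≈v′ (inj₁ (u∈ , v∈)) = inj₁ (ˡ.∈-resp-≈ u≈u′ u∈ , ʳ.∈-resp-≈ v≈v′ v∈)
    Matches-resp-≈ u≈u′ v≈v′ (inj₂ (u∈ , v∈)) = inj₂ (ʳ.∈-resp-≈ u≈u′ u∈ , ˡ.∈-resp-≈ v≈v′ v∈)

    Matches-resp : ∀ {u v u′ v′} → SameBlock u v u′ v′ → Matches u v → Matches u′ v′
    Matches-resp (inj₁ (u≈u′ , v≈v′)) = Matches-resp-≈ u≈u′ v≈v′
    Matches-resp (inj₂ (u≈v′ , v≈u′)) uv = Matches-swap (Matches-resp-≈ u≈v′ v≈u′ uv)

    Matches-covers : ∀ {x₀ y₀ z} → Matches x₀ y₀ → z ≈ x₀ ⊎ z ≈ y₀ → z ∈ ˡ.members ⊎ z ∈ ʳ.members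
    Matches-covers x₀y₀ (inj₁ z≈x₀) =
      Sum.map proj₁ proj₁ (Matches-resp-≈ (≈-sym z≈x₀) ≈-refl x₀y₀)
    Matches-covers x₀y₀ (inj₂ z≈y₀) =
      Sum.map proj₁ proj₁ (Matches-resp-≈ (≈-sym z≈y₀) ≈-refl (Matches-swap x₀y₀))

    members-sameBlock : ∀ {x₀ y₀ u v} → Matches x₀ y₀ → u ∈ ˡ.members → v ∈ ʳ.members → SameBlock u v x₀ y₀
    members-sameBlock (inj₁ (x₀∈ , y₀∈)) u∈ v∈ = inj₁ (ˡ.co-members u∈ x₀∈ , ʳ.co-members v∈ y₀∈)
    members-sameBlock (inj₂ (x₀∈ , y₀∈)) u∈ v∈ = inj₂ (ˡ.co-members u∈ y₀∈ , ʳ.co-members v∈ x₀∈)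

    members-≉ : ∀ {u v} → u ∈ ˡ.members → v ∈ ʳ.members → ¬ u ≈ v
    members-≉ u∈ v∈ u≈v = x≉y (≈-trans (≈-sym (ˡ.∈⇒≈ u∈)) (≈-trans u≈v (ʳ.∈⇒≈ v∈)))

    members-disjoint : ∀ {u} → u ∈ ˡ.members → u ∈ ʳ.members → ⊥
    members-disjoint u∈ˡ u∈ʳ = members-≉ u∈ˡ u∈ʳ ≈-refl

    crossColourAt : Fin ˡ.size → Fin ʳ.size → Fin m
    crossColourAt i j = inject≤ (col colouring (i ↑ˡ ʳ.size) (ˡ.size ↑ʳ j)) colours≤m

    crossColour : ∀ {u v} → u ∈ ˡ.members → v ∈ ʳ.members → Fin m
    crossColour u∈ v∈ = crossColourAt (index u∈) (index v∈)

    crossColour-irrelevant : ∀ {u v} (u∈ u∈′ : u ∈ ˡ.members) (v∈ v∈′ : v ∈ ʳ.members) →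
                             crossColour u∈ v∈ ≡ crossColour u∈′ v∈′
    crossColour-irrelevant u∈ u∈′ v∈ v∈′ =
      cong₂ crossColourAt (index-irrelevant ˡ.unique u∈ u∈′) (index-irrelevant ʳ.unique v∈ v∈′)

    colourOf : ∀ {u v} → Matches u v → Fin m
    colourOf (inj₁ (u∈ , v∈)) = crossColour u∈ v∈
    colourOf (inj₂ (u∈ , v∈)) = crossColour v∈ u∈

    colourOf-swap : ∀ {u v} (uv : Matches u v) (vu : Matches v u) → colourOf uv ≡ colourOf vu
    colourOf-swap (inj₁ (u∈ , v∈)) (inj₂ (v∈′ , u∈′)) = crossColour-irrelevant u∈ u∈′ v∈ v∈′
    colourOf-swap (inj₂ (u∈ , v∈)) (inj₁ (v∈′ , u∈′)) = crossColour-irrelevant v∈ v∈′ u∈ u∈′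
    colourOf-swap (inj₁ (_ , v∈ʳ)) (inj₁ (v∈ˡ , _))   = ⊥-elim (members-disjoint v∈ˡ v∈ʳ)
    colourOf-swap (inj₂ (_ , v∈ˡ)) (inj₂ (v∈ʳ , _))   = ⊥-elim (members-disjoint v∈ˡ v∈ʳ)

    colourOf-lookup : ∀ i j (uv : Matches (lookup ˡ.members i) (lookup ʳ.members j)) →
                      colourOf uv ≡ crossColourAt i j
    colourOf-lookup i j (inj₁ (u∈ , v∈)) =
      cong₂ crossColourAt (index-lookup ˡ.unique u∈) (index-lookup ʳ.unique v∈)
    colourOf-lookup i j (inj₂ (u∈ʳ , _)) = ⊥-elim (members-disjoint (∈-lookup i) u∈ʳ)

    Extends : EdgeColouring G m → Set
    Extends c = ∀ i j → col c (lookup ˡ.members i) (lookup ʳ.members j) ≡ crossColourAt i j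

    -- σ restricted to the two classes is an automorphism of K a b preserving the distinguishing colouring.
    extension-fixes : (c : EdgeColouring G m) → Extends c → ∀ σ → IsAut G σ → Preserves σ c →
                      ∀ {z} → z ∈ ˡ.members ⊎ z ∈ ʳ.members → σ ⟨$⟩ʳ z ≡ z
    extension-fixes c extends σ aut σ-preserves = Sum.[ ˡ.restrictAut-identity σ aut (proj₁ identity)
                                                      , ʳ.restrictAut-identity σ aut (proj₂ identity) ]
      where
      π : Permutation′ ˡ.size
      π = ˡ.restrictAut σ aut
      ρ : Permutation′ ʳ.size
      ρ = ʳ.restrictAut σ aut

      cross : ∀ i j → col colouring ((π ⟨$⟩ʳ i) ↑ˡ ʳ.size) (ˡ.size ↑ʳ (ρ ⟨$⟩ʳ j))
                    ≡ col colouring (i ↑ˡ ʳ.size) (ˡ.size ↑ʳ j)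
      cross i j = inject≤-injective colours≤m colours≤m _ _ (begin
          crossColourAt (π ⟨$⟩ʳ i) (ρ ⟨$⟩ʳ j)
            ≡⟨ extends _ _ ⟨
          col c (lookup ˡ.members (π ⟨$⟩ʳ i)) (lookup ʳ.members (ρ ⟨$⟩ʳ j))
            ≡⟨ cong₂ (col c) (ˡ.lookup-restrictAut σ aut i) (ʳ.lookup-restrictAut σ aut j) ⟩
          col c (σ ⟨$⟩ʳ lookup ˡ.members i) (σ ⟨$⟩ʳ lookup ʳ.members j)
            ≡⟨ σ-preserves _ _ (≉⇒adjacent (members-≉ (∈-lookup i) (∈-lookup j))) ⟩
          col c (lookup ˡ.members i) (lookup ʳ.members j)
            ≡⟨ extends i j ⟩
          crossColourAt i j
            ∎)
        where open ≡-Reasoning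

      identity : (∀ i → π ⟨$⟩ʳ i ≡ i) × (∀ j → ρ ⟨$⟩ʳ j ≡ j)
      identity = cross-preserving⇒identity colouring {π} {ρ} cross distinguishing

  WitnessFor : Fin n × Fin n → Set
  WitnessFor p = Witness (proj₁ p) (proj₂ p)

  firstColour : ∀ {X} → All WitnessFor X → Fin n → Fin n → Maybe (Fin m)
  firstColour []       u v = nothing
  firstColour (w ∷ ws) u v with matches? w u v
  ... | yes uv = just (colourOf w uv)
  ... | no _   = firstColour ws u v

  firstColour-sym : ∀ {X} (ws : All WitnessFor X) u v → firstColour ws u v ≡ firstColour ws v u
  firstColour-sym []       u v = refl
  firstColour-sym (w ∷ ws) u v with matches? w u v | matches? w v u
  ... | yes uv  | yes vu  = cong just (colourOf-swap w uv vu)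
  ... | yes uv  | no ¬vu  = ⊥-elim (¬vu (Matches-swap w uv))
  ... | no ¬uv  | yes vu  = ⊥-elim (¬uv (Matches-swap w vu))
  ... | no _    | no _    = firstColour-sym ws u v

  module _ {X p} (w : WitnessFor p) (ws : All WitnessFor X) {u v : Fin n} where

    firstColour-here : Matches w u v →
                       Σ (Matches w u v) λ uv → firstColour (w ∷ ws) u v ≡ just (colourOf w uv)
    firstColour-here uv with matches? w u v
    ... | yes uv′ = uv′ , refl
    ... | no ¬uv  = ⊥-elim (¬uv uv)

    firstColour-there : ¬ Matches w u v → firstColour (w ∷ ws) u v ≡ firstColour ws u v
    firstColour-there ¬uv with matches? w u v
    ... | yes uv = ⊥-elim (¬uv uv)
    ... | no _   = refl

  record Governing {X} (ws : All WitnessFor X) (x₀ y₀ : Fin n) : Set where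
    field
      x y     : Fin n
      witness : Witness x y
      matches : Matches witness x₀ y₀
      governs : ∀ {u v} → SameBlock u v x₀ y₀ →
                Σ (Matches witness u v) λ uv → firstColour ws u v ≡ just (colourOf witness uv)

  governedByHead : ∀ {X p x₀ y₀} (w : WitnessFor p) (ws : All WitnessFor X) →
                   Matches w x₀ y₀ → Governing (w ∷ ws) x₀ y₀
  governedByHead w ws x₀y₀ = record
    { witness = w ; matches = x₀y₀
    ; governs = λ same → firstColour-here w ws (Matches-resp w (SameBlock-sym same) x₀y₀) }

  governing : ∀ {X} (ws : All WitnessFor X) {p} → p ∈ X → Governing ws (proj₁ p) (proj₂ p)
  governing (w ∷ ws) (here refl) = governedByHead w ws (matches-self w)
  governing (w ∷ ws) {p} (there p∈X) with matches? w (proj₁ p) (proj₂ p)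
  ... | yes x₀y₀ = governedByHead w ws x₀y₀
  ... | no ¬x₀y₀ = record { witness = Rest.witness ; matches = Rest.matches ; governs = governs }
    where
    module Rest = Governing (governing ws p∈X)
    governs : ∀ {u v} → SameBlock u v (proj₁ p) (proj₂ p) →
              Σ (Matches Rest.witness u v) λ uv → firstColour (w ∷ ws) u v ≡ just (colourOf Rest.witness uv)
    governs same with Rest.governs same
    ... | uv , eq = uv , trans (firstColour-there w ws (λ uv′ → ¬x₀y₀ (Matches-resp w same uv′))) eq

  blockColouring : ∀ {X} → All WitnessFor X → Fin m → EdgeColouring G m
  blockColouring ws default = record
    { col    = λ u v → fromMaybe default (firstColour ws u v)
    ; colSym = λ u v _ → cong (fromMaybe default) (firstColour-sym ws u v) }

  blockColouring-distinguishing : ∀ {X} (ws : All WitnessFor X) default →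
    (∀ z → Any (λ p → z ≈ proj₁ p ⊎ z ≈ proj₂ p) X) → Distinguishing G (blockColouring ws default)
  blockColouring-distinguishing ws default cover σ aut σ-preserves z with find (cover z)
  ... | p , p∈X , z≈p = extension-fixes witness c extends σ aut σ-preserves (Matches-covers witness matches z≈p)
    where
    open Governing (governing ws p∈X)
    c : EdgeColouring G m
    c = blockColouring ws default
    extends : Extends witness c
    extends i j with governs (members-sameBlock witness matches (∈-lookup i) (∈-lookup j))
    ... | uv , eq = trans (cong (fromMaybe default) eq) (colourOf-lookup witness i j uv)

  D′≤-fromWitnesses : ∀ X → All WitnessFor X →
                      (∀ z → Any (λ p → z ≈ proj₁ p ⊎ z ≈ proj₂ p) X) → D′≤ G m
  D′≤-fromWitnesses [] [] cover = 0 , z≤n , noColouring , λ _ _ _ z → ⊥-elim (¬Any[] (cover z))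
    where
    noColouring : EdgeColouring G 0
    noColouring = record { col = λ u → ⊥-elim (¬Any[] (cover u)) ; colSym = λ u → ⊥-elim (¬Any[] (cover u)) }
  D′≤-fromWitnesses (_ ∷ _) ws@(w ∷ _) cover =
    m , ≤-refl , blockColouring ws default , blockColouring-distinguishing ws default cover
    where
    default : Fin m
    default = colourOf w (matches-self w)

theorem3p8 : ∀ {n1 n2} (G1 : Graph n1) (G2 : Graph n2) →
    (X : List (Fin (n1 + n2) × Fin (n1 + n2))) →
    All (λ p → ¬ SameΓ (G1 +ᴳ G2) (proj₁ p) (proj₂ p)) X →
    (∀ z → Any (λ p → SameΓ (G1 +ᴳ G2) z (proj₁ p) ⊎ SameΓ (G1 +ᴳ G2) z (proj₂ p)) X) →
    (m : ℕ) →
    All (λ p → Σ ℕ λ a → Σ ℕ λ b →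
           HasSize (λ z → SameΓ (G1 +ᴳ G2) z (proj₁ p)) a ×
           HasSize (λ z → SameΓ (G1 +ᴳ G2) z (proj₂ p)) b ×
           D′≤ (K a b) m) X →
    D′≤ (G1 +ᴳ G2) m
theorem3p8 G1 G2 X distinct cover m sizes =
  D′≤-fromWitnesses X (All.zipWith (λ (x≉y , size) → mkWitness x≉y size) (distinct , sizes)) cover
  where
  open JoinedClasses (G1 +ᴳ G2) (SameΓ-isEquivalence _) (SameΓ-aut _) (¬SameΓ⇒adjacent _) m
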